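{- Let $m\ge 2$ and $n_1,\dots,n_m\ge 1$ be integers, $N=\sum_{i=1}^m n_i$, and let $K_{n_1,\dots,n_m}$ be the complete $m$-partite graph with parts of sizes $n_1,\dots,n_m$. Let $S(n_1,\dots,n_m)$ be the number of words of length $N$ over $[m]$ using color $i$ exactly $n_i$ times, with no two consecutive equal letters and with distinct first and last letters. Let $H(n_1,\dots,n_m)$ be the number of undirected Hamiltonian cycles of $K_{n_1,\dots,n_m}$ and $H^{\rightarrow}(n_1,\dots,n_m)$ the number of directed Hamiltonian cycles (a Hamiltonian cycle and its reverse counted as distinct). Then \[ H^{\rightarrow}(n_1,\dots,n_m)=\frac{\prod_{i=1}^m (n_i!)}{N}\,S(n_1,\dots,n_m)=2\,H(n_1,\dots,n_m). \]
   Context: A directed Hamiltonian cycle is counted up to rotation (choice of starting vertex) but not up to reversal of direction. -}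

module Defs where

open import Data.Nat using (ℕ; zero; suc; _+_; _*_; _!)
open import Data.Nat.ListAction using (sum; product)
open import Data.Fin using (Fin; toℕ)
open import Data.Fin.Properties as FinP using (any?)
open import Data.Product using (Σ; Σ-syntax; _×_; _,_; proj₁)
open import Data.Product.Properties as ProdP using ()
open import Data.Sum using (_⊎_)
open import Data.List using (List; []; _∷_; _++_; map; concatMap; take; drop; reverse; length; filter; deduplicate; tabulate; allFin)
import Data.List.Properties as ListP
open import Data.List.Relation.Unary.Linked using (Linked; linked?)
open import Relation.Nullary using (¬_; Dec; ¬?)
open import Relation.Nullary.Decidable using (_×-dec_; _⊎-dec_)
open import Relation.Binary.PropositionalEquality using (_≡_; _≢_)
open import Relation.Binary.Definitions using (DecidableEquality)

total : (m : ℕ) → (Fin m → ℕ) → ℕ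
total m n = sum (tabulate n)

prodFact : (m : ℕ) → (Fin m → ℕ) → ℕ
prodFact m n = product (tabulate (λ i → n i !))

listsOf : {A : Set} → ℕ → List A → List (List A)
listsOf zero    xs = [] ∷ []
listsOf (suc k) xs = concatMap (λ x → map (x ∷_) (listsOf k xs)) xs

CyclicLinked : {A : Set} → (A → A → Set) → List A → Set
CyclicLinked R l = Linked R (l ++ take 1 l)

occ : {m : ℕ} → Fin m → List (Fin m) → ℕ
occ i w = length (filter (FinP._≟ i) w)

-- w uses colour i exactly n_i times, no two consecutive letters equal,
-- and first letter ≠ last letter (together: cyclically no equal neighbours)
GoodWord : (m : ℕ) → (Fin m → ℕ) → List (Fin m) → Set
GoodWord m n w = ((i : Fin m) → occ i w ≡ n i) × CyclicLinked _≢_ w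

allDec : {m : ℕ} {P : Fin m → Set} → ((i : Fin m) → Dec (P i)) → Dec ((i : Fin m) → P i)
allDec P? = FinP.all? P?

goodWord? : (m : ℕ) → (n : Fin m → ℕ) → (w : List (Fin m)) → Dec (GoodWord m n w)
goodWord? m n w =
  allDec (λ i → occ i w Data.Nat.≟ n i)
  ×-dec linked? (λ x y → ¬? (x FinP.≟ y)) (w ++ take 1 w)

S : (m : ℕ) → (Fin m → ℕ) → ℕ
S m n = length (filter (goodWord? m n) (listsOf (total m n) (allFin m)))

Vertex : (m : ℕ) → (Fin m → ℕ) → Set
Vertex m n = Σ[ i ∈ Fin m ] Fin (n i)

_≟V_ : {m : ℕ} {n : Fin m → ℕ} → DecidableEquality (Vertex m n)
_≟V_ = ProdP.≡-dec FinP._≟_ FinP._≟_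

vertices : (m : ℕ) → (n : Fin m → ℕ) → List (Vertex m n)
vertices m n = concatMap (λ i → map (i ,_) (allFin (n i))) (allFin m)

Adj : {m : ℕ} {n : Fin m → ℕ} → Vertex m n → Vertex m n → Set
Adj u v = proj₁ u ≢ proj₁ v

-- a Hamiltonian vertex sequence: N pairwise distinct vertices (hence every
-- vertex exactly once), consecutive ones adjacent, last adjacent to first
open import Data.List.Relation.Unary.AllPairs using (AllPairs; allPairs?)

HamSeq : (m : ℕ) → (n : Fin m → ℕ) → List (Vertex m n) → Set
HamSeq m n l = AllPairs _≢_ l × CyclicLinked Adj l

hamSeq? : (m : ℕ) → (n : Fin m → ℕ) → (l : List (Vertex m n)) → Dec (HamSeq m n l)
hamSeq? m n l =
  allPairs? (λ x y → ¬? (x ≟V y)) l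
  ×-dec linked? (λ u v → ¬? (proj₁ u FinP.≟ proj₁ v)) (l ++ take 1 l)

hamSeqs : (m : ℕ) → (n : Fin m → ℕ) → List (List (Vertex m n))
hamSeqs m n = filter (hamSeq? m n) (listsOf (total m n) (vertices m n))

rotate : {A : Set} → ℕ → List A → List A
rotate k l = drop k l ++ take k l

Rot : {A : Set} → List A → List A → Set
Rot l l' = Σ[ k ∈ Fin (length l) ] rotate (toℕ k) l ≡ l'

RotRev : {A : Set} → List A → List A → Set
RotRev l l' = Rot l l' ⊎ Rot (reverse l) l'

rot? : {A : Set} → DecidableEquality A → (l l' : List A) → Dec (Rot l l')
rot? _≟_ l l' = any? (λ k → ListP.≡-dec _≟_ (rotate (toℕ k) l) l')

rotRev? : {A : Set} → DecidableEquality A → (l l' : List A) → Dec (RotRev l l')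
rotRev? _≟_ l l' = rot? _≟_ l l' ⊎-dec rot? _≟_ (reverse l) l'

-- number of directed Hamiltonian cycles: Hamiltonian sequences up to rotation
-- (number of equivalence classes = length after removing every element
-- equivalent to an earlier one)
Hdir : (m : ℕ) → (Fin m → ℕ) → ℕ
Hdir m n = length (deduplicate (rot? _≟V_) (hamSeqs m n))

-- number of undirected Hamiltonian cycles: up to rotation and reversal
Hund : (m : ℕ) → (Fin m → ℕ) → ℕ
Hund m n = length (deduplicate (rotRev? _≟V_) (hamSeqs m n))

-- Let L be the number of Hamiltonian vertex sequences of K_{n_1,...,n_m} (closed walks through all N
-- vertices, read from a chosen start). A sequence has pairwise distinct entries, so its N rotations are
-- distinct, and for N ≥ 3 none of them is a rotation of its reversal (the successor of a vertex would
-- become its predecessor). Counting classes therefore gives L = N·H→ = 2N·H.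
-- On the other hand, a Hamiltonian sequence is exactly a repetition-free vertex sequence whose colour
-- word (the parts of its vertices) is cyclically proper. Over a fixed word w there are ∏ᵢ nᵢ(nᵢ−1)⋯(nᵢ−occᵢ(w)+1) repetition-free
-- vertex sequences; for |w| = N this is ∏ᵢ nᵢ! if w uses part i exactly nᵢ times and 0 otherwise.
-- Hence L = S·∏ᵢ nᵢ!.

module Submission where

open import Defs
open import Data.Nat using (ℕ; zero; suc; NonZero; >-nonZero; _≤_; _<_; _≤ᵇ_; _<?_; _≤?_; _≟_; _*_; _+_; _∸_; z≤n; s≤s)
open import Data.Nat.Properties
open import Data.Nat.ListAction using (sum; product)
open import Data.Nat.DivMod using (_%_; _/_; m≡m%n+[m/n]*n; m%n<n)
open import Data.Nat.ListAction.Properties using (sum-++)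
open import Data.Nat.Combinatorics using (_P_; nPn≡n!; k>n⇒nPk≡0)
open import Data.Nat.Combinatorics.Base using (_P′_)
open import Data.Fin using (Fin; toℕ; fromℕ<) renaming (zero to fzero; suc to fsuc)
import Data.Fin.Properties as FinP
open import Data.Product using (∃-syntax; _×_; _,_; proj₁; proj₂)
open import Data.Sum using (_⊎_; inj₁; inj₂)
open import Data.Empty using (⊥-elim)
open import Data.Bool using (true)
open import Data.List using (List; []; _∷_; _++_; map; concatMap; take; drop; reverse; length; filter; deduplicate; tabulate; allFin)
import Data.List.Properties as ListP
open import Data.List.Relation.Unary.Any using (Any; here; there)
import Data.List.Relation.Unary.Any as Any
import Data.List.Relation.Unary.Any.Properties as AnyP
open import Data.List.Relation.Unary.Linked using (Linked; []; [-]; _∷_; linked?)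
import Data.List.Relation.Unary.Linked.Properties as LinkedP
open import Data.List.Relation.Unary.AllPairs using (allPairs?)
import Data.List.Relation.Unary.All as All
open import Data.List.Relation.Unary.All using (All; []; _∷_)
open import Data.List.Membership.Propositional using (_∈_; _∉_)
open import Data.List.Membership.Propositional.Properties
open import Data.List.Relation.Unary.Unique.Propositional using (Unique)
import Data.List.Relation.Unary.AllPairs as AllPairs
import Data.List.Relation.Unary.AllPairs.Properties as AllPairsP
import Data.List.Relation.Unary.All.Properties as AllP
import Data.List.Relation.Unary.Unique.Propositional.Properties as Unique
open import Data.List.Relation.Binary.Disjoint.Propositional using (Disjoint)
open import Relation.Nullary using (¬_; Dec; yes; no; ¬?)
open import Relation.Nullary.Decidable using (_×-dec_)
open import Relation.Binary.Definitions using (Decidable; DecidableEquality; Symmetric; Transitive)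
open import Relation.Binary.PropositionalEquality
open import Function using (_∘_)
import Algebra.Properties.CommutativeSemigroup +-commutativeSemigroup as +-CS
import Algebra.Properties.CommutativeSemigroup *-commutativeSemigroup as *-CS

-- Indicators, finite sums and products

𝟙 : {P : Set} → Dec P → ℕ
𝟙 (yes _) = 1
𝟙 (no _)  = 0

𝟙-yes : {P : Set} → P → (d : Dec P) → 𝟙 d ≡ 1
𝟙-yes p (yes _) = refl
𝟙-yes p (no ¬p) = ⊥-elim (¬p p)

𝟙-no : {P : Set} → ¬ P → (d : Dec P) → 𝟙 d ≡ 0
𝟙-no ¬p (yes p) = ⊥-elim (¬p p)
𝟙-no ¬p (no _)  = refl

𝟙-cong : {P Q : Set} → (P → Q) → (Q → P) → (p : Dec P) (q : Dec Q) → 𝟙 p ≡ 𝟙 q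
𝟙-cong f g (yes p) q = sym (𝟙-yes (f p) q)
𝟙-cong f g (no ¬p) q = sym (𝟙-no (λ q → ¬p (g q)) q)

𝟙-× : {P Q : Set} (p : Dec P) (q : Dec Q) → 𝟙 (p ×-dec q) ≡ 𝟙 p * 𝟙 q
𝟙-× (yes _) (yes _) = refl
𝟙-× (yes _) (no _)  = refl
𝟙-× (no _)  _       = refl

𝟙-¬+𝟙 : {P : Set} (d : Dec P) → 𝟙 (¬? d) + 𝟙 d ≡ 1
𝟙-¬+𝟙 (yes _) = refl
𝟙-¬+𝟙 (no _)  = refl

∑ : {A : Set} → List A → (A → ℕ) → ℕ
∑ xs f = sum (map f xs)

syntax ∑ xs (λ x → e) = ∑[ x ∈ xs ] e

module _ {A : Set} where

  ∑-++ : (xs ys : List A) (f : A → ℕ) → ∑ (xs ++ ys) f ≡ ∑ xs f + ∑ ys f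
  ∑-++ xs ys f = trans (cong sum (ListP.map-++ f xs ys)) (sum-++ (map f xs) (map f ys))

  ∑-cong-∈ : (xs : List A) {f g : A → ℕ} → (∀ {x} → x ∈ xs → f x ≡ g x) → ∑ xs f ≡ ∑ xs g
  ∑-cong-∈ []       e = refl
  ∑-cong-∈ (x ∷ xs) e = cong₂ _+_ (e (here refl)) (∑-cong-∈ xs (e ∘ there))

  ∑-cong : (xs : List A) {f g : A → ℕ} → (∀ x → f x ≡ g x) → ∑ xs f ≡ ∑ xs g
  ∑-cong xs e = ∑-cong-∈ xs (λ {x} _ → e x)

  ∑-distrib-+ : (xs : List A) (f g : A → ℕ) → ∑[ x ∈ xs ] (f x + g x) ≡ ∑ xs f + ∑ xs g
  ∑-distrib-+ []       f g = refl
  ∑-distrib-+ (x ∷ xs) f g = trans (cong (f x + g x +_) (∑-distrib-+ xs f g)) (+-CS.interchange (f x) (g x) _ _)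

  ∑-*ˡ : (xs : List A) (c : ℕ) (f : A → ℕ) → ∑[ x ∈ xs ] (c * f x) ≡ c * ∑ xs f
  ∑-*ˡ []       c f = sym (*-zeroʳ c)
  ∑-*ˡ (x ∷ xs) c f = trans (cong (c * f x +_) (∑-*ˡ xs c f)) (sym (*-distribˡ-+ c (f x) (∑ xs f)))

  ∑-*ʳ : (xs : List A) (c : ℕ) (f : A → ℕ) → ∑[ x ∈ xs ] (f x * c) ≡ ∑ xs f * c
  ∑-*ʳ xs c f = trans (∑-cong xs (λ x → *-comm (f x) c)) (trans (∑-*ˡ xs c f) (*-comm c _))

  ∑-const : (xs : List A) (c : ℕ) → ∑[ x ∈ xs ] c ≡ c * length xs
  ∑-const []       c = sym (*-zeroʳ c)
  ∑-const (x ∷ xs) c = trans (cong (c +_) (∑-const xs c)) (sym (*-suc c (length xs)))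

  ∑-0 : (xs : List A) {f : A → ℕ} → (∀ {x} → x ∈ xs → f x ≡ 0) → ∑ xs f ≡ 0
  ∑-0 xs e = trans (∑-cong-∈ xs e) (∑-const xs 0)

  ∑-mono-≤ : (xs : List A) {f g : A → ℕ} → (∀ x → f x ≤ g x) → ∑ xs f ≤ ∑ xs g
  ∑-mono-≤ []       le = z≤n
  ∑-mono-≤ (x ∷ xs) le = +-mono-≤ (le x) (∑-mono-≤ xs le)

  ∑-≤∧≡⇒≡ : (xs : List A) {f g : A → ℕ} → (∀ x → f x ≤ g x) → ∑ xs f ≡ ∑ xs g → ∀ {x} → x ∈ xs → f x ≡ g x
  ∑-≤∧≡⇒≡ (x ∷ xs) {f} {g} le eq (here refl) = ≤-antisym (le x) gx≤fx
    where
    gx≤fx : g x ≤ f x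
    gx≤fx = +-cancelʳ-≤ (∑ xs g) (g x) (f x) (≤-trans (≤-reflexive (sym eq)) (+-monoʳ-≤ (f x) (∑-mono-≤ xs le)))
  ∑-≤∧≡⇒≡ (x ∷ xs) {f} {g} le eq (there y∈) = ∑-≤∧≡⇒≡ xs le tail-eq y∈
    where
    tail-eq : ∑ xs f ≡ ∑ xs g
    tail-eq = +-cancelˡ-≡ (f x) _ _ (trans eq (cong (_+ ∑ xs g) (sym (∑-≤∧≡⇒≡ (x ∷ xs) le eq (here refl)))))

  ∑-filter : {P : A → Set} (P? : ∀ x → Dec (P x)) (xs : List A) (f : A → ℕ) →
    ∑ (filter P? xs) f ≡ ∑[ x ∈ xs ] (𝟙 (P? x) * f x)
  ∑-filter P? []       f = refl
  ∑-filter P? (x ∷ xs) f with P? x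
  ... | yes _ = cong₂ _+_ (sym (+-identityʳ (f x))) (∑-filter P? xs f)
  ... | no _  = ∑-filter P? xs f

  length-filter≡∑𝟙 : {P : A → Set} (P? : ∀ x → Dec (P x)) (xs : List A) → length (filter P? xs) ≡ ∑[ x ∈ xs ] 𝟙 (P? x)
  length-filter≡∑𝟙 P? []       = refl
  length-filter≡∑𝟙 P? (x ∷ xs) with P? x
  ... | yes _ = cong suc (length-filter≡∑𝟙 P? xs)
  ... | no _  = length-filter≡∑𝟙 P? xs

module _ {A B : Set} where

  ∑-map : (g : A → B) (xs : List A) (f : B → ℕ) → ∑ (map g xs) f ≡ ∑[ x ∈ xs ] f (g x)
  ∑-map g xs f = cong sum (sym (ListP.map-∘ xs))

  ∑-concatMap : (g : A → List B) (xs : List A) (f : B → ℕ) → ∑ (concatMap g xs) f ≡ ∑[ x ∈ xs ] ∑ (g x) f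
  ∑-concatMap g []       f = refl
  ∑-concatMap g (x ∷ xs) f = trans (∑-++ (g x) (concatMap g xs) f) (cong (∑ (g x) f +_) (∑-concatMap g xs f))

  ∑-comm : (xs : List A) (ys : List B) (f : A → B → ℕ) → ∑[ x ∈ xs ] ∑[ y ∈ ys ] f x y ≡ ∑[ y ∈ ys ] ∑[ x ∈ xs ] f x y
  ∑-comm []       ys f = sym (∑-const ys 0)
  ∑-comm (x ∷ xs) ys f = trans (cong (∑ ys (f x) +_) (∑-comm xs ys f)) (sym (∑-distrib-+ ys (f x) _))

sum-tabulate : {k : ℕ} (f : Fin k → ℕ) → sum (tabulate f) ≡ ∑ (allFin k) f
sum-tabulate f = cong sum (sym (ListP.map-tabulate (λ i → i) f))

module Multiplicity {A : Set} (_≟_ : DecidableEquality A) where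
  open import Data.List.Membership.DecPropositional _≟_ using (_∈?_)

  count : A → List A → ℕ
  count z xs = ∑[ y ∈ xs ] 𝟙 (y ≟ z)

  count-∉ : ∀ {z} xs → z ∉ xs → count z xs ≡ 0
  count-∉     []       z∉ = refl
  count-∉ {z} (x ∷ xs) z∉ = cong₂ _+_ (𝟙-no (λ x≡z → z∉ (here (sym x≡z))) (x ≟ z)) (count-∉ xs (z∉ ∘ there))

  count-∈ : ∀ {z xs} → Unique xs → z ∈ xs → count z xs ≡ 1
  count-∈ {xs = x ∷ xs} (x∉xs AllPairs.∷ u) (here refl) =
    cong₂ _+_ (𝟙-yes refl (x ≟ x)) (count-∉ xs (λ x∈ → All.lookup x∉xs x∈ refl))
  count-∈ {z} {x ∷ xs} (x∉xs AllPairs.∷ u) (there z∈) =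
    cong₂ _+_ (𝟙-no (All.lookup x∉xs z∈) (x ≟ z)) (count-∈ u z∈)

  𝟙-∈≡count : ∀ {xs} → Unique xs → ∀ z → 𝟙 (z ∈? xs) ≡ count z xs
  𝟙-∈≡count {xs} u z with z ∈? xs
  ... | yes z∈ = sym (count-∈ u z∈)
  ... | no z∉  = sym (count-∉ _ z∉)

  ∑𝟙≡length : {R : A → Set} (R? : ∀ y → Dec (R y)) {M L : List A} → Unique M → Unique L →
    (∀ {y} → R y → y ∈ M) → (∀ {y} → y ∈ M → R y) → (∀ {z} → z ∈ M → z ∈ L) →
    ∑[ y ∈ L ] 𝟙 (R? y) ≡ length M
  ∑𝟙≡length R? {M} {L} uM uL R⇒∈M ∈M⇒R M⊆L = begin
    ∑[ y ∈ L ] 𝟙 (R? y)                     ≡⟨ ∑-cong L (λ y → 𝟙-cong R⇒∈M ∈M⇒R (R? y) (y ∈? M)) ⟩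
    ∑[ y ∈ L ] 𝟙 (y ∈? M)                   ≡⟨ ∑-cong L (𝟙-∈≡count uM) ⟩
    ∑[ y ∈ L ] ∑[ z ∈ M ] 𝟙 (z ≟ y)         ≡⟨ ∑-comm L M (λ y z → 𝟙 (z ≟ y)) ⟩
    ∑[ z ∈ M ] ∑[ y ∈ L ] 𝟙 (z ≟ y)         ≡⟨ ∑-cong-∈ M (λ {z} z∈ → trans (∑-cong L (λ y → 𝟙-cong sym sym (z ≟ y) (y ≟ z))) (count-∈ uL (M⊆L z∈))) ⟩
    ∑[ z ∈ M ] 1                            ≡⟨ trans (∑-const M 1) (*-identityˡ _) ⟩
    length M                                ∎
    where open ≡-Reasoning

∏ : {k : ℕ} → (Fin k → ℕ) → ℕ
∏ f = product (tabulate f)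

∏-cong : {k : ℕ} {f g : Fin k → ℕ} → (∀ i → f i ≡ g i) → ∏ f ≡ ∏ g
∏-cong {zero}  e = refl
∏-cong {suc k} e = cong₂ _*_ (e fzero) (∏-cong (e ∘ fsuc))

∏-1 : (k : ℕ) → ∏ {k} (λ _ → 1) ≡ 1
∏-1 zero    = refl
∏-1 (suc k) = trans (+-identityʳ _) (∏-1 k)

∏-0 : {k : ℕ} (f : Fin k → ℕ) (i : Fin k) → f i ≡ 0 → ∏ f ≡ 0
∏-0 f fzero    fi≡0 = cong (_* ∏ (f ∘ fsuc)) fi≡0
∏-0 f (fsuc i) fi≡0 = trans (cong (f fzero *_) (∏-0 (f ∘ fsuc) i fi≡0)) (*-zeroʳ (f fzero))

∏-update : {k : ℕ} (f g : Fin k → ℕ) (c : Fin k) (a : ℕ) →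
  (∀ i → i ≢ c → g i ≡ f i) → g c ≡ a * f c → ∏ g ≡ a * ∏ f
∏-update f g fzero a off at = begin
  g fzero * ∏ (g ∘ fsuc)   ≡⟨ cong₂ _*_ at (∏-cong (λ i → off (fsuc i) (λ ()))) ⟩
  a * f fzero * ∏ (f ∘ fsuc) ≡⟨ *-assoc a (f fzero) _ ⟩
  a * ∏ f                  ∎
  where open ≡-Reasoning
∏-update f g (fsuc c) a off at = begin
  g fzero * ∏ (g ∘ fsuc)       ≡⟨ cong₂ _*_ (off fzero (λ ())) (∏-update (f ∘ fsuc) (g ∘ fsuc) c a off′ at) ⟩
  f fzero * (a * ∏ (f ∘ fsuc)) ≡⟨ *-CS.x∙yz≈y∙xz (f fzero) a _ ⟩
  a * ∏ f                      ∎
  where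
  open ≡-Reasoning
  off′ : ∀ i → i ≢ c → g (fsuc i) ≡ f (fsuc i)
  off′ i i≢c = off (fsuc i) (i≢c ∘ FinP.suc-injective)

P≡P′ : ∀ {a k} → k ≤ a → a P k ≡ a P′ k
P≡P′ {a} {k} k≤a with k ≤ᵇ a | ≤⇒≤ᵇ k≤a
... | true | _ = refl

P-suc : ∀ a k → a P suc k ≡ (a ∸ k) * (a P k)
P-suc a k with k <? a
... | yes k<a = trans (P≡P′ k<a) (cong ((a ∸ k) *_) (sym (P≡P′ (<⇒≤ k<a))))
... | no k≮a  = trans (k>n⇒nPk≡0 (s≤s (≮⇒≥ k≮a))) (sym (cong (_* (a P k)) (m≤n⇒m∸n≡0 (≮⇒≥ k≮a))))

module _ {A : Set} where

  ∈-listsOf⁻ : ∀ k (xs : List A) {l} → l ∈ listsOf k xs → length l ≡ k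
  ∈-listsOf⁻ zero    xs (here refl) = refl
  ∈-listsOf⁻ (suc k) xs l∈ with ∈-concatMap⁻ (λ x → map (x ∷_) (listsOf k xs)) {xs = xs} l∈
  ... | x∈ with Any.satisfied x∈
  ... | x , l∈′ with ∈-map⁻ (x ∷_) l∈′
  ... | l′ , l′∈ , refl = cong suc (∈-listsOf⁻ k xs l′∈)

  ∈-listsOf⁺ : (xs l : List A) → All (_∈ xs) l → l ∈ listsOf (length l) xs
  ∈-listsOf⁺ xs []      []          = here refl
  ∈-listsOf⁺ xs (x ∷ l) (x∈ ∷ l⊆xs) = ∈-concatMap⁺ (λ y → map (y ∷_) (listsOf (length l) xs)) {xs = xs}
    (Any.map (λ { refl → ∈-map⁺ (x ∷_) (∈-listsOf⁺ xs l l⊆xs) }) x∈)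

  ∑-listsOf-suc : ∀ k (xs : List A) (f : List A → ℕ) → ∑ (listsOf (suc k) xs) f ≡ ∑[ x ∈ xs ] ∑[ l ∈ listsOf k xs ] f (x ∷ l)
  ∑-listsOf-suc k xs f = trans (∑-concatMap (λ x → map (x ∷_) (listsOf k xs)) xs f)
                               (∑-cong xs (λ x → ∑-map (x ∷_) (listsOf k xs) f))

  listsOf-unique : ∀ k {xs : List A} → Unique xs → Unique (listsOf k xs)
  listsOf-unique zero    u = [] AllPairs.∷ AllPairs.[]
  listsOf-unique (suc k) {xs} u =
    Unique.concat⁺ (AllP.map⁺ (All.tabulate (λ _ → Unique.map⁺ ListP.∷-injectiveʳ (listsOf-unique k u))))
                   (AllPairsP.map⁺ (AllPairs.map disjoint u))
    where
    disjoint : ∀ {x y} → x ≢ y → Disjoint (map (x ∷_) (listsOf k xs)) (map (y ∷_) (listsOf k xs))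
    disjoint x≢y (v∈₁ , v∈₂) with ∈-map⁻ _ v∈₁ | ∈-map⁻ _ v∈₂
    ... | _ , _ , refl | _ , _ , e = x≢y (ListP.∷-injectiveˡ e)

-- Counting equivalence classes

module _ {A : Set} {R : A → A → Set} (R? : Decidable R) (R-sym : Symmetric R) (R-trans : Transitive R) where

  ∑-deduplicate-𝟙≡1 : ∀ xs {y} → Any (λ z → R z y) xs → ∑[ d ∈ deduplicate R? xs ] 𝟙 (R? d y) ≡ 1
  ∑-deduplicate-𝟙≡1 (x ∷ xs) {y} z~y with R? x y
  ... | yes x~y = cong suc (trans (∑-filter (¬? ∘ R? x) (deduplicate R? xs) (λ d → 𝟙 (R? d y)))
                                  (∑-0 (deduplicate R? xs) (λ {d} _ → not-both d)))
    where
    not-both : ∀ d → 𝟙 (¬? (R? x d)) * 𝟙 (R? d y) ≡ 0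
    not-both d with R? x d | R? d y
    ... | yes _   | _       = refl
    ... | no x≁d  | yes d~y = ⊥-elim (x≁d (R-trans x~y (R-sym d~y)))
    ... | no _    | no _    = refl
  ... | no x≁y = trans (∑-filter (¬? ∘ R? x) (deduplicate R? xs) (λ d → 𝟙 (R? d y)))
                       (trans (∑-cong (deduplicate R? xs) filter-irrelevant) (∑-deduplicate-𝟙≡1 xs (tail z~y)))
    where
    filter-irrelevant : ∀ d → 𝟙 (¬? (R? x d)) * 𝟙 (R? d y) ≡ 𝟙 (R? d y)
    filter-irrelevant d with R? x d | R? d y
    ... | yes x~d | yes d~y = ⊥-elim (x≁y (R-trans x~d d~y))
    ... | yes _   | no _    = refl
    ... | no _    | yes _   = refl
    ... | no _    | no _    = refl
    tail : Any (λ z → R z y) (x ∷ xs) → Any (λ z → R z y) xs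
    tail (here x~y)  = ⊥-elim (x≁y x~y)
    tail (there z~y) = z~y

  -- Each class meets deduplicate R? L exactly once.
  length≡*-length-deduplicate : (L : List A) (c : ℕ) → (∀ {y} → y ∈ L → R y y) →
    (∀ {d} → d ∈ L → ∑[ y ∈ L ] 𝟙 (R? d y) ≡ c) → length L ≡ c * length (deduplicate R? L)
  length≡*-length-deduplicate L c R-refl classSize = begin
    length L                                          ≡⟨ sym (trans (∑-const L 1) (*-identityˡ _)) ⟩
    ∑[ y ∈ L ] 1                                      ≡⟨ ∑-cong-∈ L (λ y∈ → sym (∑-deduplicate-𝟙≡1 L (Any.map (λ { refl → R-refl y∈ }) y∈))) ⟩
    ∑[ y ∈ L ] ∑[ d ∈ D ] 𝟙 (R? d y)                  ≡⟨ ∑-comm L D (λ y d → 𝟙 (R? d y)) ⟩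
    ∑[ d ∈ D ] ∑[ y ∈ L ] 𝟙 (R? d y)                  ≡⟨ ∑-cong-∈ D (λ d∈ → classSize (∈-deduplicate⁻ R? L d∈)) ⟩
    ∑[ d ∈ D ] c                                      ≡⟨ ∑-const D c ⟩
    c * length D                                      ∎
    where
    open ≡-Reasoning
    D : List A
    D = deduplicate R? L

-- Rotations of lists

module Rotation {A : Set} where

  rotate₁ : List A → List A
  rotate₁ []       = []
  rotate₁ (x ∷ xs) = xs ++ x ∷ []

  rotate′ : ℕ → List A → List A
  rotate′ zero    l = l
  rotate′ (suc k) l = rotate₁ (rotate′ k l)

  length-rotate₁ : ∀ l → length (rotate₁ l) ≡ length l
  length-rotate₁ []       = refl
  length-rotate₁ (x ∷ xs) = trans (ListP.length-++ xs) (+-comm (length xs) 1)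

  length-rotate′ : ∀ k l → length (rotate′ k l) ≡ length l
  length-rotate′ zero    l = refl
  length-rotate′ (suc k) l = trans (length-rotate₁ (rotate′ k l)) (length-rotate′ k l)

  rotate′-[] : ∀ k → rotate′ k [] ≡ []
  rotate′-[] zero    = refl
  rotate′-[] (suc k) = cong rotate₁ (rotate′-[] k)

  rotate′-+ : ∀ a b l → rotate′ (a + b) l ≡ rotate′ a (rotate′ b l)
  rotate′-+ zero    b l = refl
  rotate′-+ (suc a) b l = cong rotate₁ (rotate′-+ a b l)

  drop-take-suc : ∀ k (xs : List A) → k < length xs →
    ∃[ x ] drop k xs ≡ x ∷ drop (suc k) xs × take (suc k) xs ≡ take k xs ++ x ∷ []
  drop-take-suc zero    (x ∷ xs) _         = x , refl , refl
  drop-take-suc (suc k) (y ∷ xs) (s≤s k<n) with drop-take-suc k xs k<n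
  ... | x , d , t = x , d , cong (y ∷_) t

  rotate-suc : ∀ k (xs : List A) → k < length xs → rotate (suc k) xs ≡ rotate₁ (rotate k xs)
  rotate-suc k xs k<n with drop-take-suc k xs k<n
  ... | x , d , t rewrite d | t = sym (ListP.++-assoc (drop (suc k) xs) (take k xs) (x ∷ []))

  rotate≡rotate′ : ∀ k (xs : List A) → k ≤ length xs → rotate k xs ≡ rotate′ k xs
  rotate≡rotate′ zero    xs _   = ListP.++-identityʳ xs
  rotate≡rotate′ (suc k) xs k<n = trans (rotate-suc k xs k<n) (cong rotate₁ (rotate≡rotate′ k xs (<⇒≤ k<n)))

  rotate′-length : ∀ l → rotate′ (length l) l ≡ l
  rotate′-length l = trans (sym (rotate≡rotate′ (length l) l ≤-refl))
    (cong₂ _++_ (ListP.drop-all (length l) l ≤-refl) (ListP.take-all (length l) l ≤-refl))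

  rotate′-*-length : ∀ q l → rotate′ (q * length l) l ≡ l
  rotate′-*-length zero    l = refl
  rotate′-*-length (suc q) l = begin
    rotate′ (length l + q * length l) l       ≡⟨ rotate′-+ (length l) (q * length l) l ⟩
    rotate′ (length l) (rotate′ (q * length l) l) ≡⟨ cong (rotate′ (length l)) (rotate′-*-length q l) ⟩
    rotate′ (length l) l                      ≡⟨ rotate′-length l ⟩
    l                                         ∎
    where open ≡-Reasoning

  rotate′-% : ∀ a l → .{{_ : NonZero (length l)}} → rotate′ a l ≡ rotate′ (a % length l) l
  rotate′-% a l = begin
    rotate′ a l                                                ≡⟨ cong (λ t → rotate′ t l) (m≡m%n+[m/n]*n a (length l)) ⟩
    rotate′ (a % length l + a / length l * length l) l         ≡⟨ rotate′-+ (a % length l) _ l ⟩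
    rotate′ (a % length l) (rotate′ (a / length l * length l) l) ≡⟨ cong (rotate′ (a % length l)) (rotate′-*-length (a / length l) l) ⟩
    rotate′ (a % length l) l                                   ∎
    where open ≡-Reasoning

  rotate′-inverse : ∀ a l → rotate′ ((length l ∸ 1) * a) (rotate′ a l) ≡ l
  rotate′-inverse a []       = rotate′-[] a
  rotate′-inverse a (x ∷ xs) = trans (sym (rotate′-+ (length xs * a) a (x ∷ xs)))
    (trans (cong (λ t → rotate′ t (x ∷ xs)) (trans (+-comm (length xs * a) a) (*-comm (length (x ∷ xs)) a)))
           (rotate′-*-length a (x ∷ xs)))

  rotate₁-reverse-rotate₁ : ∀ l → rotate₁ (reverse (rotate₁ l)) ≡ reverse l
  rotate₁-reverse-rotate₁ []       = refl
  rotate₁-reverse-rotate₁ (x ∷ xs) = begin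
    rotate₁ (reverse (xs ++ x ∷ [])) ≡⟨ cong rotate₁ (ListP.reverse-++ xs (x ∷ [])) ⟩
    rotate₁ (x ∷ reverse xs)         ≡⟨ ListP.unfold-reverse x xs ⟨
    reverse (x ∷ xs)                 ∎
    where open ≡-Reasoning

  reverse-rotate₁ : ∀ l → reverse (rotate₁ l) ≡ rotate′ (length l ∸ 1) (reverse l)
  reverse-rotate₁ []         = refl
  reverse-rotate₁ l@(x ∷ xs) = sym (begin
    rotate′ (length xs) (reverse l)           ≡⟨ cong (rotate′ (length xs)) (rotate₁-reverse-rotate₁ l) ⟨
    rotate′ (length xs) (rotate₁ r)           ≡⟨ rotate′-+ (length xs) 1 r ⟨
    rotate′ (length xs + 1) r                 ≡⟨ cong (λ t → rotate′ t r) length-r ⟩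
    rotate′ (length r) r                      ≡⟨ rotate′-length r ⟩
    r                                         ∎)
    where
    open ≡-Reasoning
    r : List A
    r = reverse (rotate₁ l)
    length-r : length xs + 1 ≡ length r
    length-r = trans (+-comm (length xs) 1) (sym (trans (ListP.length-reverse (rotate₁ l)) (length-rotate₁ l)))

  reverse-rotate′ : ∀ a l → reverse (rotate′ a l) ≡ rotate′ (a * (length l ∸ 1)) (reverse l)
  reverse-rotate′ zero    l = refl
  reverse-rotate′ (suc a) l = begin
    reverse (rotate₁ (rotate′ a l))                                   ≡⟨ reverse-rotate₁ (rotate′ a l) ⟩
    rotate′ (length (rotate′ a l) ∸ 1) (reverse (rotate′ a l))          ≡⟨ cong₂ (λ t u → rotate′ (t ∸ 1) u) (length-rotate′ a l) (reverse-rotate′ a l) ⟩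
    rotate′ (length l ∸ 1) (rotate′ (a * (length l ∸ 1)) (reverse l)) ≡⟨ rotate′-+ (length l ∸ 1) _ (reverse l) ⟨
    rotate′ (suc a * (length l ∸ 1)) (reverse l)                      ∎
    where open ≡-Reasoning

  Rot⇒rotate′ : ∀ {x y : List A} → Rot x y → ∃[ a ] rotate′ a x ≡ y
  Rot⇒rotate′ {x} (k , e) = toℕ k , trans (sym (rotate≡rotate′ (toℕ k) x (FinP.toℕ≤n k))) e

  rotate′⇒Rot : ∀ a {x y : List A} → 0 < length x → rotate′ a x ≡ y → Rot x y
  rotate′⇒Rot a {x@(_ ∷ _)} {y} _ e = fromℕ< a%n<n , (begin
    rotate (toℕ (fromℕ< a%n<n)) x ≡⟨ cong (λ t → rotate t x) (FinP.toℕ-fromℕ< a%n<n) ⟩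
    rotate (a % length x) x       ≡⟨ rotate≡rotate′ (a % length x) x (<⇒≤ a%n<n) ⟩
    rotate′ (a % length x) x      ≡⟨ rotate′-% a x ⟨
    rotate′ a x                   ≡⟨ e ⟩
    y                             ∎)
    where
    open ≡-Reasoning
    a%n<n = m%n<n a (length x)

  Rot-nonempty : ∀ {x y : List A} → Rot x y → 0 < length x
  Rot-nonempty {[]}    (() , _)
  Rot-nonempty {_ ∷ _} _ = s≤s z≤n

  Rot-length : ∀ {x y : List A} → Rot x y → length y ≡ length x
  Rot-length r with Rot⇒rotate′ r
  ... | a , refl = length-rotate′ a _

  Rot-refl : ∀ {x : List A} → 0 < length x → Rot x x
  Rot-refl x≢[] = rotate′⇒Rot 0 x≢[] refl

  Rot-sym : Symmetric (Rot {A})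
  Rot-sym {x} r with Rot⇒rotate′ r
  ... | a , refl = rotate′⇒Rot ((length x ∸ 1) * a) (subst (0 <_) (sym (Rot-length r)) (Rot-nonempty r)) (rotate′-inverse a x)

  Rot-trans : Transitive (Rot {A})
  Rot-trans r s with Rot⇒rotate′ r | Rot⇒rotate′ s
  ... | a , refl | b , refl = rotate′⇒Rot (b + a) (Rot-nonempty r) (rotate′-+ b a _)

  Rot-reverse : ∀ {x y : List A} → Rot x y → Rot (reverse x) (reverse y)
  Rot-reverse {x} r with Rot⇒rotate′ r
  ... | a , refl = rotate′⇒Rot (a * (length x ∸ 1))
    (subst (0 <_) (sym (ListP.length-reverse x)) (Rot-nonempty r)) (sym (reverse-rotate′ a x))

  Rot-reverseˡ : ∀ {x y : List A} → Rot (reverse x) y → Rot x (reverse y)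
  Rot-reverseˡ {x} r = subst (λ t → Rot t _) (ListP.reverse-involutive x) (Rot-reverse r)

  RotRev-sym : Symmetric (RotRev {A})
  RotRev-sym (inj₁ r) = inj₁ (Rot-sym r)
  RotRev-sym (inj₂ r) = inj₂ (Rot-sym (Rot-reverseˡ r))

  RotRev-trans : Transitive (RotRev {A})
  RotRev-trans (inj₁ r) (inj₁ s) = inj₁ (Rot-trans r s)
  RotRev-trans (inj₁ r) (inj₂ s) = inj₂ (Rot-trans (Rot-reverse r) s)
  RotRev-trans (inj₂ r) (inj₁ s) = inj₂ (Rot-trans r s)
  RotRev-trans (inj₂ r) (inj₂ s) = inj₁ (Rot-trans (Rot-reverseˡ r) s)

  rotations : List A → List (List A)
  rotations x = map (λ k → rotate (toℕ k) x) (allFin (length x))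

  length-rotations : ∀ x → length (rotations x) ≡ length x
  length-rotations x = trans (ListP.length-map _ (allFin (length x))) (ListP.length-tabulate {n = length x} (λ k → k))

  Rot⇒∈-rotations : ∀ {x y : List A} → Rot x y → y ∈ rotations x
  Rot⇒∈-rotations {x} (k , refl) = ∈-map⁺ (λ k → rotate (toℕ k) x) (∈-allFin k)

  ∈-rotations⇒Rot : ∀ {x y : List A} → y ∈ rotations x → Rot x y
  ∈-rotations⇒Rot {x} y∈ with ∈-map⁻ (λ k → rotate (toℕ k) x) y∈
  ... | k , _ , e = k , sym e

  ∈-drop : ∀ k (xs : List A) {a d} → drop k xs ≡ a ∷ d → a ∈ xs
  ∈-drop zero    (x ∷ xs) refl = here refl
  ∈-drop (suc k) (x ∷ xs) e    = there (∈-drop k xs e)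

  drop-injective : ∀ k j (xs : List A) {a d e} → Unique xs → drop k xs ≡ a ∷ d → drop j xs ≡ a ∷ e → k ≡ j
  drop-injective zero    zero    xs       u                  _  _  = refl
  drop-injective zero    (suc j) (x ∷ xs) (x∉ AllPairs.∷ _) refl q = ⊥-elim (All.lookup x∉ (∈-drop j xs q) refl)
  drop-injective (suc k) zero    (x ∷ xs) (x∉ AllPairs.∷ _) p refl = ⊥-elim (All.lookup x∉ (∈-drop k xs p) refl)
  drop-injective (suc k) (suc j) (x ∷ xs) (_ AllPairs.∷ u)  p  q  = cong suc (drop-injective k j xs u p q)

  rotate-injective : ∀ (x : List A) → Unique x → ∀ {k j : Fin (length x)} → rotate (toℕ k) x ≡ rotate (toℕ j) x → k ≡ j
  rotate-injective x u {k} {j} e with drop-take-suc (toℕ k) x (FinP.toℕ<n k) | drop-take-suc (toℕ j) x (FinP.toℕ<n j)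
  ... | a , p , _ | b , q , _ with ListP.∷-injectiveˡ (trans (sym (cong (_++ take (toℕ k) x) p)) (trans e (cong (_++ take (toℕ j) x) q)))
  ... | refl = FinP.toℕ-injective (drop-injective (toℕ k) (toℕ j) x u p q)

  rotations-unique : ∀ (x : List A) → Unique x → Unique (rotations x)
  rotations-unique x u = Unique.map⁺ (rotate-injective x u) (Unique.allFin⁺ (length x))

  data Consecutive (a b : A) : List A → Set where
    here  : ∀ {xs} → Consecutive a b (a ∷ b ∷ xs)
    there : ∀ {x xs} → Consecutive a b xs → Consecutive a b (x ∷ xs)

  CyclicSucc : A → A → List A → Set
  CyclicSucc a b l = Consecutive a b (l ++ take 1 l)

  Consecutive-++ʳ : ∀ {a b} xs ys → Consecutive a b xs → Consecutive a b (xs ++ ys)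
  Consecutive-++ʳ (_ ∷ _ ∷ _) ys here      = here
  Consecutive-++ʳ (_ ∷ xs)    ys (there c) = there (Consecutive-++ʳ xs ys c)

  Consecutive-middle : ∀ {a b} ps qs → Consecutive a b (ps ++ a ∷ b ∷ qs)
  Consecutive-middle []       qs = here
  Consecutive-middle (p ∷ ps) qs = there (Consecutive-middle ps qs)

  Consecutive-∷ʳ⁻ : ∀ {a b u v} ps → Consecutive a b (ps ++ u ∷ v ∷ []) → Consecutive a b (ps ++ u ∷ []) ⊎ (a ≡ u × b ≡ v)
  Consecutive-∷ʳ⁻ []            here              = inj₂ (refl , refl)
  Consecutive-∷ʳ⁻ []            (there (there ()))
  Consecutive-∷ʳ⁻ (p ∷ [])      here              = inj₁ here
  Consecutive-∷ʳ⁻ (p ∷ p′ ∷ ps) here              = inj₁ here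
  Consecutive-∷ʳ⁻ (p ∷ ps)      (there c) with Consecutive-∷ʳ⁻ ps c
  ... | inj₁ c′ = inj₁ (there c′)
  ... | inj₂ e  = inj₂ e

  Consecutive-reverse : ∀ {a b} zs → Consecutive a b zs → Consecutive b a (reverse zs)
  Consecutive-reverse {a} {b} (a ∷ b ∷ r) here = subst (Consecutive b a) (sym reverse-abr) (Consecutive-middle (reverse r) [])
    where
    reverse-abr : reverse (a ∷ b ∷ r) ≡ reverse r ++ b ∷ a ∷ []
    reverse-abr = trans (ListP.unfold-reverse a (b ∷ r))
      (trans (cong (_++ a ∷ []) (ListP.unfold-reverse b r)) (ListP.++-assoc (reverse r) (b ∷ []) (a ∷ [])))
  Consecutive-reverse (z ∷ zs) (there c) =
    subst (Consecutive _ _) (sym (ListP.unfold-reverse z zs)) (Consecutive-++ʳ (reverse zs) (z ∷ []) (Consecutive-reverse zs c))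

  Consecutive⇒∈ : ∀ {a b h} l → Consecutive a b (l ++ h ∷ []) → a ∈ l
  Consecutive⇒∈ []          (there ())
  Consecutive⇒∈ (y ∷ [])    here               = here refl
  Consecutive⇒∈ (y ∷ [])    (there (there ()))
  Consecutive⇒∈ (y ∷ z ∷ l) here               = here refl
  Consecutive⇒∈ (y ∷ z ∷ l) (there c)          = there (Consecutive⇒∈ (z ∷ l) c)

  Consecutive-functional : ∀ {a b c h} l → Unique l → Consecutive a b (l ++ h ∷ []) → Consecutive a c (l ++ h ∷ []) → b ≡ c
  Consecutive-functional []          u                   (there ()) _
  Consecutive-functional (y ∷ [])    u                   here       here               = refl
  Consecutive-functional (y ∷ [])    u                   here       (there (there ()))
  Consecutive-functional (y ∷ [])    u                   (there (there ())) _
  Consecutive-functional (y ∷ z ∷ l) u                   here       here       = refl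
  Consecutive-functional (y ∷ z ∷ l) (y∉ AllPairs.∷ u)  here       (there q)  = ⊥-elim (All.lookup y∉ (Consecutive⇒∈ (z ∷ l) q) refl)
  Consecutive-functional (y ∷ z ∷ l) (y∉ AllPairs.∷ u)  (there p)  here       = ⊥-elim (All.lookup y∉ (Consecutive⇒∈ (z ∷ l) p) refl)
  Consecutive-functional (y ∷ z ∷ l) (_ AllPairs.∷ u)   (there p)  (there q)  = Consecutive-functional (z ∷ l) u p q

  rotate₁-cyclic : ∀ (y z : A) zs → rotate₁ (y ∷ z ∷ zs) ++ take 1 (rotate₁ (y ∷ z ∷ zs)) ≡ (z ∷ zs) ++ y ∷ z ∷ []
  rotate₁-cyclic y z zs = cong (z ∷_) (ListP.++-assoc zs (y ∷ []) (z ∷ []))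

  reverse-closed : ∀ (y : A) ys → reverse ((y ∷ ys) ++ y ∷ []) ≡ (y ∷ reverse ys) ++ y ∷ []
  reverse-closed y ys = trans (ListP.reverse-++ (y ∷ ys) (y ∷ [])) (cong (y ∷_) (ListP.unfold-reverse y ys))

  CyclicSucc-rotate₁⁺ : ∀ l {a b} → CyclicSucc a b l → CyclicSucc a b (rotate₁ l)
  CyclicSucc-rotate₁⁺ (y ∷ [])     c         = c
  CyclicSucc-rotate₁⁺ (y ∷ z ∷ zs) here      = subst (Consecutive y z) (sym (rotate₁-cyclic y z zs)) (Consecutive-middle (z ∷ zs) [])
  CyclicSucc-rotate₁⁺ (y ∷ z ∷ zs) (there c) = Consecutive-++ʳ (z ∷ zs ++ y ∷ []) (z ∷ []) c

  CyclicSucc-rotate₁⁻ : ∀ l {a b} → CyclicSucc a b (rotate₁ l) → CyclicSucc a b l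
  CyclicSucc-rotate₁⁻ (y ∷ [])     c = c
  CyclicSucc-rotate₁⁻ (y ∷ z ∷ zs) c with Consecutive-∷ʳ⁻ (z ∷ zs) (subst (Consecutive _ _) (rotate₁-cyclic y z zs) c)
  ... | inj₁ c′          = there c′
  ... | inj₂ (refl , refl) = here

  CyclicSucc-rotate′⁺ : ∀ k l {a b} → CyclicSucc a b l → CyclicSucc a b (rotate′ k l)
  CyclicSucc-rotate′⁺ zero    l c = c
  CyclicSucc-rotate′⁺ (suc k) l c = CyclicSucc-rotate₁⁺ (rotate′ k l) (CyclicSucc-rotate′⁺ k l c)

  CyclicSucc-rotate′⁻ : ∀ k l {a b} → CyclicSucc a b (rotate′ k l) → CyclicSucc a b l
  CyclicSucc-rotate′⁻ zero    l c = c
  CyclicSucc-rotate′⁻ (suc k) l c = CyclicSucc-rotate′⁻ k l (CyclicSucc-rotate₁⁻ (rotate′ k l) c)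

  CyclicSucc-reverse⁻ : ∀ (l : List A) {a b} → CyclicSucc a b (reverse l) → CyclicSucc b a l
  CyclicSucc-reverse⁻ (y ∷ ys) {a} {b} c = subst (Consecutive b a) (ListP.reverse-involutive ((y ∷ ys) ++ y ∷ []))
      (Consecutive-reverse _ (subst (Consecutive a b) (sym (reverse-closed y ys))
        (CyclicSucc-rotate₁⁻ (y ∷ reverse ys) (subst (CyclicSucc a b) (ListP.unfold-reverse y ys) c))))

  -- b follows a in every rotation of a ∷ b ∷ c ∷ r but precedes it in every rotation of the reversal.
  rotations-reverse-disjoint : ∀ (x : List A) → Unique x → 3 ≤ length x → Disjoint (rotations x) (rotations (reverse x))
  rotations-reverse-disjoint (_ ∷ [])     _ (s≤s ())
  rotations-reverse-disjoint (_ ∷ _ ∷ []) _ (s≤s (s≤s ()))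
  rotations-reverse-disjoint x@(a ∷ b ∷ c ∷ r) u _ (y∈₁ , y∈₂)
    with Rot⇒rotate′ (∈-rotations⇒Rot y∈₁) | Rot⇒rotate′ (∈-rotations⇒Rot y∈₂)
  ... | k , refl | j , e = a≢c (Consecutive-functional x u b↝a b↝c)
    where
    b↝c : CyclicSucc b c x
    b↝c = there here
    b↝a : CyclicSucc b a x
    b↝a = CyclicSucc-reverse⁻ x (CyclicSucc-rotate′⁻ j (reverse x) (subst (CyclicSucc a b) (sym e) (CyclicSucc-rotate′⁺ k x here)))
    a≢c : a ≢ c
    a≢c = All.lookup (AllPairs.head u) (there (here refl))

  Unique-rotate₁ : ∀ (l : List A) → Unique l → Unique (rotate₁ l)
  Unique-rotate₁ []       u                 = u
  Unique-rotate₁ (y ∷ ys) (y∉ AllPairs.∷ u) = Unique.++⁺ u ([] AllPairs.∷ AllPairs.[]) (λ { (v∈ , here refl) → All.lookup y∉ v∈ refl })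

  Unique-rotate′ : ∀ k (l : List A) → Unique l → Unique (rotate′ k l)
  Unique-rotate′ zero    l u = u
  Unique-rotate′ (suc k) l u = Unique-rotate₁ (rotate′ k l) (Unique-rotate′ k l u)

  Unique-reverse : ∀ (l : List A) → Unique l → Unique (reverse l)
  Unique-reverse []       u                 = u
  Unique-reverse (y ∷ ys) (y∉ AllPairs.∷ u) = subst Unique (sym (ListP.unfold-reverse y ys))
    (Unique.++⁺ (Unique-reverse ys u) ([] AllPairs.∷ AllPairs.[]) (λ { (v∈ , here refl) → All.lookup y∉ (AnyP.reverse⁻ v∈) refl }))

  module _ {R : A → A → Set} where

    Linked-∷ʳ : ∀ xs {a b} → Linked R (xs ++ a ∷ []) → R a b → Linked R (xs ++ a ∷ b ∷ [])
    Linked-∷ʳ []           [-]       r = r ∷ [-]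
    Linked-∷ʳ (x ∷ [])     (r′ ∷ [-]) r = r′ ∷ r ∷ [-]
    Linked-∷ʳ (x ∷ y ∷ xs) (r′ ∷ l)   r = r′ ∷ Linked-∷ʳ (y ∷ xs) l r

    CyclicLinked-rotate₁ : ∀ l → CyclicLinked R l → CyclicLinked R (rotate₁ l)
    CyclicLinked-rotate₁ []           c       = c
    CyclicLinked-rotate₁ (y ∷ [])     c       = c
    CyclicLinked-rotate₁ (y ∷ z ∷ zs) (r ∷ c) = subst (Linked R) (sym (rotate₁-cyclic y z zs)) (Linked-∷ʳ (z ∷ zs) c r)

    CyclicLinked-rotate′ : ∀ k l → CyclicLinked R l → CyclicLinked R (rotate′ k l)
    CyclicLinked-rotate′ zero    l c = c
    CyclicLinked-rotate′ (suc k) l c = CyclicLinked-rotate₁ (rotate′ k l) (CyclicLinked-rotate′ k l c)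

    module _ (R-sym : Symmetric R) where

      Linked-reverse : ∀ zs → Linked R zs → Linked R (reverse zs)
      Linked-reverse []           c       = c
      Linked-reverse (z ∷ [])     c       = c
      Linked-reverse (z ∷ w ∷ ws) (r ∷ c) = subst (Linked R) (sym reverse-zww)
        (Linked-∷ʳ (reverse ws) (subst (Linked R) (ListP.unfold-reverse w ws) (Linked-reverse (w ∷ ws) c)) (R-sym r))
        where
        reverse-zww : reverse (z ∷ w ∷ ws) ≡ reverse ws ++ w ∷ z ∷ []
        reverse-zww = trans (ListP.unfold-reverse z (w ∷ ws))
          (trans (cong (_++ z ∷ []) (ListP.unfold-reverse w ws)) (ListP.++-assoc (reverse ws) (w ∷ []) (z ∷ [])))

      CyclicLinked-reverse : ∀ l → CyclicLinked R l → CyclicLinked R (reverse l)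
      CyclicLinked-reverse []       c = c
      CyclicLinked-reverse (y ∷ ys) c = subst (CyclicLinked R) (sym (ListP.unfold-reverse y ys))
        (CyclicLinked-rotate₁ (y ∷ reverse ys) (subst (Linked R) (reverse-closed y ys) (Linked-reverse _ c)))

-- Directed and undirected Hamiltonian cycles

module HamiltonianCycles (m : ℕ) (n : Fin m → ℕ) where
  open Rotation
  open Multiplicity (ListP.≡-dec (_≟V_ {m} {n})) using (∑𝟙≡length)

  N : ℕ
  N = total m n

  vertices-complete : ∀ (v : Vertex m n) → v ∈ vertices m n
  vertices-complete (i , j) = ∈-concatMap⁺ (λ i → map (i ,_) (allFin (n i))) {xs = allFin m}
    (Any.map (λ { refl → ∈-map⁺ (i ,_) (∈-allFin j) }) (∈-allFin i))

  vertices-unique : Unique (vertices m n)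
  vertices-unique = Unique.concat⁺ (AllP.map⁺ (All.tabulate (λ {i} _ → Unique.map⁺ injective (Unique.allFin⁺ (n i)))))
                                   (AllPairsP.map⁺ (AllPairs.map disjoint (Unique.allFin⁺ m)))
    where
    injective : ∀ {i} {j j′ : Fin (n i)} → (i , j) ≡ (i , j′) → j ≡ j′
    injective refl = refl
    disjoint : ∀ {i i′ : Fin m} → i ≢ i′ → Disjoint (map (i ,_) (allFin (n i))) (map (i′ ,_) (allFin (n i′)))
    disjoint i≢i′ (v∈₁ , v∈₂) with ∈-map⁻ _ v∈₁ | ∈-map⁻ _ v∈₂
    ... | _ , _ , refl | _ , _ , e = i≢i′ (cong proj₁ e)

  hamSeqs-unique : Unique (hamSeqs m n)
  hamSeqs-unique = Unique.filter⁺ (hamSeq? m n) (listsOf-unique N vertices-unique)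

  ∈-hamSeqs⁻ : ∀ {y} → y ∈ hamSeqs m n → HamSeq m n y × length y ≡ N
  ∈-hamSeqs⁻ y∈ with ∈-filter⁻ (hamSeq? m n) {xs = listsOf N (vertices m n)} y∈
  ... | y∈′ , h = h , ∈-listsOf⁻ N (vertices m n) y∈′

  ∈-hamSeqs⁺ : ∀ {y} → HamSeq m n y → length y ≡ N → y ∈ hamSeqs m n
  ∈-hamSeqs⁺ {y} h e = ∈-filter⁺ (hamSeq? m n)
    (subst (λ k → y ∈ listsOf k (vertices m n)) e (∈-listsOf⁺ (vertices m n) y (All.tabulate (λ {v} _ → vertices-complete v)))) h

  hamSeqs-rotate′ : ∀ k {y} → y ∈ hamSeqs m n → rotate′ k y ∈ hamSeqs m n
  hamSeqs-rotate′ k {y} y∈ with ∈-hamSeqs⁻ y∈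
  ... | (u , c) , e = ∈-hamSeqs⁺ (Unique-rotate′ k y u , CyclicLinked-rotate′ k y c) (trans (length-rotate′ k y) e)

  hamSeqs-reverse : ∀ {y} → y ∈ hamSeqs m n → reverse y ∈ hamSeqs m n
  hamSeqs-reverse {y} y∈ with ∈-hamSeqs⁻ y∈
  ... | (u , c) , e = ∈-hamSeqs⁺ (Unique-reverse y u , CyclicLinked-reverse (λ i≢j → i≢j ∘ sym) y c) (trans (ListP.length-reverse y) e)

  rotations⊆hamSeqs : ∀ {d} → d ∈ hamSeqs m n → ∀ {y} → y ∈ rotations d → y ∈ hamSeqs m n
  rotations⊆hamSeqs d∈ y∈ with Rot⇒rotate′ (∈-rotations⇒Rot y∈)
  ... | k , refl = hamSeqs-rotate′ k d∈

  Rot-classSize : ∀ {d} → d ∈ hamSeqs m n → ∑[ y ∈ hamSeqs m n ] 𝟙 (rot? _≟V_ d y) ≡ N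
  Rot-classSize {d} d∈ = trans
    (∑𝟙≡length (rot? _≟V_ d) (rotations-unique d u) hamSeqs-unique Rot⇒∈-rotations ∈-rotations⇒Rot (rotations⊆hamSeqs d∈))
    (trans (length-rotations d) e)
    where
    u : Unique d
    u = proj₁ (proj₁ (∈-hamSeqs⁻ d∈))
    e : length d ≡ N
    e = proj₂ (∈-hamSeqs⁻ d∈)

  RotRev-classSize : 3 ≤ N → ∀ {d} → d ∈ hamSeqs m n → ∑[ y ∈ hamSeqs m n ] 𝟙 (rotRev? _≟V_ d y) ≡ 2 * N
  RotRev-classSize N≥3 {d} d∈ = begin
    ∑[ y ∈ hamSeqs m n ] 𝟙 (rotRev? _≟V_ d y)   ≡⟨ ∑𝟙≡length (rotRev? _≟V_ d) M-unique hamSeqs-unique RotRev⇒∈ ∈⇒RotRev M⊆hamSeqs ⟩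
    length M                                    ≡⟨ ListP.length-++ (rotations d) ⟩
    length (rotations d) + length (rotations (reverse d))
      ≡⟨ cong₂ _+_ (length-rotations d) (trans (length-rotations (reverse d)) (ListP.length-reverse d)) ⟩
    length d + length d                         ≡⟨ cong₂ _+_ e (trans e (sym (+-identityʳ N))) ⟩
    2 * N                                       ∎
    where
    open ≡-Reasoning
    u : Unique d
    u = proj₁ (proj₁ (∈-hamSeqs⁻ d∈))
    e : length d ≡ N
    e = proj₂ (∈-hamSeqs⁻ d∈)
    M : List (List (Vertex m n))
    M = rotations d ++ rotations (reverse d)
    M-unique : Unique M
    M-unique = Unique.++⁺ (rotations-unique d u) (rotations-unique (reverse d) (Unique-reverse d u))
      (rotations-reverse-disjoint d u (subst (3 ≤_) (sym e) N≥3))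
    RotRev⇒∈ : ∀ {y} → RotRev d y → y ∈ M
    RotRev⇒∈ (inj₁ r) = ∈-++⁺ˡ (Rot⇒∈-rotations r)
    RotRev⇒∈ (inj₂ r) = ∈-++⁺ʳ (rotations d) (Rot⇒∈-rotations r)
    ∈⇒RotRev : ∀ {y} → y ∈ M → RotRev d y
    ∈⇒RotRev y∈ with ∈-++⁻ (rotations d) y∈
    ... | inj₁ y∈′ = inj₁ (∈-rotations⇒Rot y∈′)
    ... | inj₂ y∈′ = inj₂ (∈-rotations⇒Rot y∈′)
    M⊆hamSeqs : ∀ {y} → y ∈ M → y ∈ hamSeqs m n
    M⊆hamSeqs y∈ with ∈-++⁻ (rotations d) y∈
    ... | inj₁ y∈′ = rotations⊆hamSeqs d∈ y∈′
    ... | inj₂ y∈′ = rotations⊆hamSeqs (hamSeqs-reverse d∈) y∈′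

  hamSeqs-Rot-refl : 0 < N → ∀ {y} → y ∈ hamSeqs m n → Rot y y
  hamSeqs-Rot-refl N>0 y∈ = Rot-refl (subst (0 <_) (sym (proj₂ (∈-hamSeqs⁻ y∈))) N>0)

  length-hamSeqs≡N*Hdir : 0 < N → length (hamSeqs m n) ≡ N * Hdir m n
  length-hamSeqs≡N*Hdir N>0 =
    length≡*-length-deduplicate (rot? _≟V_) Rot-sym Rot-trans (hamSeqs m n) N (hamSeqs-Rot-refl N>0) Rot-classSize

  length-hamSeqs≡2N*Hund : 3 ≤ N → length (hamSeqs m n) ≡ 2 * N * Hund m n
  length-hamSeqs≡2N*Hund N≥3 =
    length≡*-length-deduplicate (rotRev? _≟V_) RotRev-sym RotRev-trans (hamSeqs m n) (2 * N)
      (inj₁ ∘ hamSeqs-Rot-refl (<-≤-trans (s≤s z≤n) N≥3)) (RotRev-classSize N≥3)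

  Hdir≡2*Hund : 3 ≤ N → Hdir m n ≡ 2 * Hund m n
  Hdir≡2*Hund N≥3 = *-cancelˡ-≡ (Hdir m n) (2 * Hund m n) N {{>-nonZero N>0}} (begin
    N * Hdir m n         ≡⟨ length-hamSeqs≡N*Hdir N>0 ⟨
    length (hamSeqs m n) ≡⟨ length-hamSeqs≡2N*Hund N≥3 ⟩
    2 * N * Hund m n     ≡⟨ *-assoc 2 N (Hund m n) ⟩
    2 * (N * Hund m n)   ≡⟨ *-CS.x∙yz≈y∙xz 2 N (Hund m n) ⟩
    N * (2 * Hund m n)   ∎)
    where
    open ≡-Reasoning
    N>0 : 0 < N
    N>0 = <-≤-trans (s≤s z≤n) N≥3

-- Hamiltonian sequences counted through their colour words

occ≡∑ : ∀ {m} (c : Fin m) w → occ c w ≡ ∑[ x ∈ w ] 𝟙 (x FinP.≟ c)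
occ≡∑ c w = length-filter≡∑𝟙 (FinP._≟ c) w

∑-occ : ∀ {m} (w : List (Fin m)) → ∑[ i ∈ allFin m ] occ i w ≡ length w
∑-occ {m} w = begin
  ∑[ i ∈ allFin m ] occ i w                        ≡⟨ ∑-cong (allFin m) (λ i → occ≡∑ i w) ⟩
  ∑[ i ∈ allFin m ] ∑[ x ∈ w ] 𝟙 (x FinP.≟ i)      ≡⟨ ∑-comm (allFin m) w (λ i x → 𝟙 (x FinP.≟ i)) ⟩
  ∑[ x ∈ w ] ∑[ i ∈ allFin m ] 𝟙 (x FinP.≟ i)      ≡⟨ ∑-cong w (λ x → trans (∑-cong (allFin m) (λ i → 𝟙-cong sym sym (x FinP.≟ i) (i FinP.≟ x)))
                                                                             (count-∈ (Unique.allFin⁺ m) (∈-allFin x))) ⟩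
  ∑[ x ∈ w ] 1                                     ≡⟨ trans (∑-const w 1) (*-identityˡ _) ⟩
  length w                                         ∎
  where
  open ≡-Reasoning
  open Multiplicity FinP._≟_ using (count-∈)

module ColourWords (m : ℕ) (n : Fin m → ℕ) where
  open import Data.List.Membership.DecPropositional (_≟V_ {m} {n}) using (_∈?_)
  open Multiplicity (_≟V_ {m} {n}) using (𝟙-∈≡count)

  V : List (Vertex m n)
  V = vertices m n

  W : List (Fin m)
  W = allFin m

  colours : List (Vertex m n) → List (Fin m)
  colours = map proj₁

  unique? : (l : List (Vertex m n)) → Dec (Unique l)
  unique? = allPairs? (λ x y → ¬? (x ≟V y))

  ∑-vertices : (h : Vertex m n → ℕ) → ∑ V h ≡ ∑[ c ∈ W ] ∑[ j ∈ allFin (n c) ] h (c , j)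
  ∑-vertices h = trans (∑-concatMap (λ i → map (i ,_) (allFin (n i))) W h)
    (∑-cong W (λ c → ∑-map (c ,_) (allFin (n c)) h))

  ∑-part : ∀ c (v : Vertex m n) → ∑[ j ∈ allFin (n c) ] 𝟙 (v ≟V (c , j)) ≡ 𝟙 (proj₁ v FinP.≟ c)
  ∑-part c (c′ , j′) = by-colour (c′ FinP.≟ c)
    where
    by-colour : (d : Dec (c′ ≡ c)) → ∑[ j ∈ allFin (n c) ] 𝟙 ((c′ , j′) ≟V (c , j)) ≡ 𝟙 d
    by-colour (yes refl) = trans (∑-cong (allFin (n c)) (λ j → 𝟙-cong (λ { refl → refl }) (λ { refl → refl }) ((c , j′) ≟V (c , j)) (j FinP.≟ j′)))
                                 (Multiplicity.count-∈ FinP._≟_ (Unique.allFin⁺ (n c)) (∈-allFin j′))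
    by-colour (no c′≢c)  = ∑-0 (allFin (n c)) (λ {j} _ → 𝟙-no (c′≢c ∘ cong proj₁) ((c′ , j′) ≟V (c , j)))

  occupied-in-part : ∀ {l} → Unique l → ∀ c → ∑[ j ∈ allFin (n c) ] 𝟙 ((c , j) ∈? l) ≡ occ c (colours l)
  occupied-in-part {l} u c = begin
    ∑[ j ∈ allFin (n c) ] 𝟙 ((c , j) ∈? l)                 ≡⟨ ∑-cong (allFin (n c)) (λ j → 𝟙-∈≡count u (c , j)) ⟩
    ∑[ j ∈ allFin (n c) ] ∑[ v ∈ l ] 𝟙 (v ≟V (c , j))      ≡⟨ ∑-comm (allFin (n c)) l (λ j v → 𝟙 (v ≟V (c , j))) ⟩
    ∑[ v ∈ l ] ∑[ j ∈ allFin (n c) ] 𝟙 (v ≟V (c , j))      ≡⟨ ∑-cong l (∑-part c) ⟩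
    ∑[ v ∈ l ] 𝟙 (proj₁ v FinP.≟ c)                        ≡⟨ ∑-map proj₁ l (λ x → 𝟙 (x FinP.≟ c)) ⟨
    ∑[ x ∈ colours l ] 𝟙 (x FinP.≟ c)                      ≡⟨ occ≡∑ c (colours l) ⟨
    occ c (colours l)                                      ∎
    where open ≡-Reasoning

  free-in-part : ∀ {l} → Unique l → ∀ c → ∑[ j ∈ allFin (n c) ] 𝟙 (¬? ((c , j) ∈? l)) ≡ n c ∸ occ c (colours l)
  free-in-part {l} u c = begin
    free                   ≡⟨ m+n∸n≡m free (occ c (colours l)) ⟨
    free + occ c (colours l) ∸ occ c (colours l) ≡⟨ cong (_∸ occ c (colours l)) free+occupied ⟩
    n c ∸ occ c (colours l) ∎
    where
    open ≡-Reasoning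
    free : ℕ
    free = ∑[ j ∈ allFin (n c) ] 𝟙 (¬? ((c , j) ∈? l))
    free+occupied : free + occ c (colours l) ≡ n c
    free+occupied = begin
      free + occ c (colours l)                  ≡⟨ cong (free +_) (occupied-in-part u c) ⟨
      free + ∑[ j ∈ allFin (n c) ] 𝟙 ((c , j) ∈? l) ≡⟨ ∑-distrib-+ (allFin (n c)) _ _ ⟨
      ∑[ j ∈ allFin (n c) ] (𝟙 (¬? ((c , j) ∈? l)) + 𝟙 ((c , j) ∈? l)) ≡⟨ ∑-cong (allFin (n c)) (λ j → 𝟙-¬+𝟙 ((c , j) ∈? l)) ⟩
      ∑[ j ∈ allFin (n c) ] 1                   ≡⟨ trans (∑-const (allFin (n c)) 1) (trans (*-identityˡ _) (ListP.length-tabulate (λ j → j))) ⟩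
      n c                                       ∎

  unique?-∷ : ∀ v l → 𝟙 (unique? (v ∷ l)) ≡ 𝟙 (¬? (v ∈? l)) * 𝟙 (unique? l)
  unique?-∷ v l = trans
    (𝟙-cong (λ { (v∉ AllPairs.∷ u) → AllP.All¬⇒¬Any v∉ , u }) (λ { (v∉ , u) → AllP.¬Any⇒All¬ l v∉ AllPairs.∷ u })
            (unique? (v ∷ l)) (¬? (v ∈? l) ×-dec unique? l))
    (𝟙-× (¬? (v ∈? l)) (unique? l))

  fibreSize : List (Fin m) → ℕ
  fibreSize w = ∏ (λ i → n i P occ i w)

  fibreSize-[] : fibreSize [] ≡ 1
  fibreSize-[] = ∏-1 m

  occ-∷ : ∀ (c′ c : Fin m) w → occ c (c′ ∷ w) ≡ 𝟙 (c′ FinP.≟ c) + occ c w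
  occ-∷ c′ c w with c′ FinP.≟ c
  ... | yes _ = refl
  ... | no _  = refl

  fibreSize-∷ : ∀ c w → fibreSize (c ∷ w) ≡ (n c ∸ occ c w) * fibreSize w
  fibreSize-∷ c w = ∏-update (λ i → n i P occ i w) (λ i → n i P occ i (c ∷ w)) c (n c ∸ occ c w) off at
    where
    off : ∀ i → i ≢ c → n i P occ i (c ∷ w) ≡ n i P occ i w
    off i i≢c = cong (n i P_) (trans (occ-∷ c i w) (cong (_+ occ i w) (𝟙-no (i≢c ∘ sym) (c FinP.≟ i))))
    at : n c P occ c (c ∷ w) ≡ (n c ∸ occ c w) * (n c P occ c w)
    at = trans (cong (n c P_) (trans (occ-∷ c c w) (cong (_+ occ c w) (𝟙-yes refl (c FinP.≟ c))))) (P-suc (n c) (occ c w))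

  ∑-extensions : (g : List (Fin m) → ℕ) → ∀ {l} → Unique l →
    ∑[ v ∈ V ] (𝟙 (¬? (v ∈? l)) * g (proj₁ v ∷ colours l)) ≡ ∑[ c ∈ W ] ((n c ∸ occ c (colours l)) * g (c ∷ colours l))
  ∑-extensions g {l} u = trans (∑-vertices (λ v → 𝟙 (¬? (v ∈? l)) * g (proj₁ v ∷ colours l)))
    (∑-cong W (λ c → trans (∑-*ʳ (allFin (n c)) (g (c ∷ colours l)) (λ j → 𝟙 (¬? ((c , j) ∈? l))))
                           (cong (_* g (c ∷ colours l)) (free-in-part u c))))

  -- Grouping injective vertex sequences by their colour word w: the group of w has fibreSize w members.
  ∑-unique-by-colours : ∀ k (g : List (Fin m) → ℕ) →
    ∑[ l ∈ listsOf k V ] (𝟙 (unique? l) * g (colours l)) ≡ ∑[ w ∈ listsOf k W ] (g w * fibreSize w)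
  ∑-unique-by-colours zero    g = cong (_+ 0) (trans (+-identityʳ (g [])) (sym (trans (cong (g [] *_) fibreSize-[]) (*-identityʳ (g [])))))
  ∑-unique-by-colours (suc k) g = begin
    ∑[ l ∈ listsOf (suc k) V ] (𝟙 (unique? l) * g (colours l))
      ≡⟨ ∑-listsOf-suc k V (λ l → 𝟙 (unique? l) * g (colours l)) ⟩
    ∑[ v ∈ V ] ∑[ l ∈ listsOf k V ] (𝟙 (unique? (v ∷ l)) * g (proj₁ v ∷ colours l))
      ≡⟨ ∑-cong V (λ v → ∑-cong (listsOf k V) (λ l → split-head v l)) ⟩
    ∑[ v ∈ V ] ∑[ l ∈ listsOf k V ] (𝟙 (unique? l) * (𝟙 (¬? (v ∈? l)) * g (proj₁ v ∷ colours l)))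
      ≡⟨ ∑-comm V (listsOf k V) _ ⟩
    ∑[ l ∈ listsOf k V ] ∑[ v ∈ V ] (𝟙 (unique? l) * (𝟙 (¬? (v ∈? l)) * g (proj₁ v ∷ colours l)))
      ≡⟨ ∑-cong (listsOf k V) extend ⟩
    ∑[ l ∈ listsOf k V ] (𝟙 (unique? l) * g′ (colours l))
      ≡⟨ ∑-unique-by-colours k g′ ⟩
    ∑[ w ∈ listsOf k W ] (g′ w * fibreSize w)
      ≡⟨ ∑-cong (listsOf k W) distribute ⟩
    ∑[ w ∈ listsOf k W ] ∑[ c ∈ W ] (g (c ∷ w) * fibreSize (c ∷ w))
      ≡⟨ ∑-comm (listsOf k W) W _ ⟩
    ∑[ c ∈ W ] ∑[ w ∈ listsOf k W ] (g (c ∷ w) * fibreSize (c ∷ w))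
      ≡⟨ ∑-listsOf-suc k W (λ w → g w * fibreSize w) ⟨
    ∑[ w ∈ listsOf (suc k) W ] (g w * fibreSize w)
      ∎
    where
    open ≡-Reasoning
    g′ : List (Fin m) → ℕ
    g′ w = ∑[ c ∈ W ] ((n c ∸ occ c w) * g (c ∷ w))
    split-head : ∀ v l → 𝟙 (unique? (v ∷ l)) * g (proj₁ v ∷ colours l) ≡ 𝟙 (unique? l) * (𝟙 (¬? (v ∈? l)) * g (proj₁ v ∷ colours l))
    split-head v l = trans (cong (_* g (proj₁ v ∷ colours l)) (trans (unique?-∷ v l) (*-comm (𝟙 (¬? (v ∈? l))) (𝟙 (unique? l)))))
                           (*-assoc (𝟙 (unique? l)) (𝟙 (¬? (v ∈? l))) (g (proj₁ v ∷ colours l)))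
    extend : ∀ l → ∑[ v ∈ V ] (𝟙 (unique? l) * (𝟙 (¬? (v ∈? l)) * g (proj₁ v ∷ colours l))) ≡ 𝟙 (unique? l) * g′ (colours l)
    extend l with unique? l
    ... | yes u = trans (∑-*ˡ V 1 _) (cong (1 *_) (∑-extensions g u))
    ... | no _  = ∑-*ˡ V 0 (λ v → 𝟙 (¬? (v ∈? l)) * g (proj₁ v ∷ colours l))
    distribute : ∀ w → g′ w * fibreSize w ≡ ∑[ c ∈ W ] (g (c ∷ w) * fibreSize (c ∷ w))
    distribute w = trans (sym (∑-*ʳ W (fibreSize w) (λ c → (n c ∸ occ c w) * g (c ∷ w))))
      (∑-cong W (λ c → trans (cong (_* fibreSize w) (*-comm (n c ∸ occ c w) _))
                      (trans (*-assoc (g (c ∷ w)) _ _) (cong (g (c ∷ w) *_) (sym (fibreSize-∷ c w))))))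

  properlyColoured? : (w : List (Fin m)) → Dec (CyclicLinked _≢_ w)
  properlyColoured? w = linked? (λ x y → ¬? (x FinP.≟ y)) (w ++ take 1 w)

  colours-cyclic : ∀ l → map proj₁ (l ++ take 1 l) ≡ colours l ++ take 1 (colours l)
  colours-cyclic l = trans (ListP.map-++ proj₁ l (take 1 l)) (cong (colours l ++_) (sym (ListP.take-map 1 l)))

  𝟙-hamSeq? : ∀ l → 𝟙 (hamSeq? m n l) ≡ 𝟙 (unique? l) * 𝟙 (properlyColoured? (colours l))
  𝟙-hamSeq? l = trans (𝟙-× (unique? l) adjacent?) (cong (𝟙 (unique? l) *_)
    (𝟙-cong (λ a → subst (Linked _≢_) (colours-cyclic l) (LinkedP.map⁺ a))
            (λ c → LinkedP.map⁻ (subst (Linked _≢_) (sym (colours-cyclic l)) c))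
            adjacent? (properlyColoured? (colours l))))
    where
    adjacent? : Dec (CyclicLinked Adj l)
    adjacent? = linked? (λ u v → ¬? (proj₁ u FinP.≟ proj₁ v)) (l ++ take 1 l)

  -- If some colour is used less than n i times, another is used more, since both counts sum to N; its factor vanishes.
  fibreSize-length-N : ∀ w → length w ≡ total m n → fibreSize w ≡ 𝟙 (allDec (λ i → occ i w ≟ n i)) * prodFact m n
  fibreSize-length-N w |w|≡N = by-balance (allDec (λ i → occ i w ≟ n i))
    where
    ≤⇒balanced : (∀ i → occ i w ≤ n i) → ∀ i → occ i w ≡ n i
    ≤⇒balanced le i = ∑-≤∧≡⇒≡ W le (trans (∑-occ w) (trans |w|≡N (sum-tabulate n))) (∈-allFin i)
    by-balance : (d : Dec (∀ i → occ i w ≡ n i)) → fibreSize w ≡ 𝟙 d * prodFact m n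
    by-balance (yes balanced) = trans (∏-cong (λ i → trans (cong (n i P_) (balanced i)) (nPn≡n! (n i)))) (sym (*-identityˡ _))
    by-balance (no unbalanced) with FinP.¬∀⟶∃¬ m _ (λ i → occ i w ≤? n i) (unbalanced ∘ ≤⇒balanced)
    ... | i , occ≰n = ∏-0 _ i (k>n⇒nPk≡0 (≰⇒> occ≰n))

  length-hamSeqs : length (hamSeqs m n) ≡ S m n * prodFact m n
  length-hamSeqs = begin
    length (hamSeqs m n)                                                 ≡⟨ length-filter≡∑𝟙 (hamSeq? m n) (listsOf N V) ⟩
    ∑[ l ∈ listsOf N V ] 𝟙 (hamSeq? m n l)                                ≡⟨ ∑-cong (listsOf N V) 𝟙-hamSeq? ⟩
    ∑[ l ∈ listsOf N V ] (𝟙 (unique? l) * 𝟙 (properlyColoured? (colours l))) ≡⟨ ∑-unique-by-colours N (𝟙 ∘ properlyColoured?) ⟩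
    ∑[ w ∈ listsOf N W ] (𝟙 (properlyColoured? w) * fibreSize w)          ≡⟨ ∑-cong-∈ (listsOf N W) (λ {w} w∈ → weight {w} (∈-listsOf⁻ N W w∈)) ⟩
    ∑[ w ∈ listsOf N W ] (𝟙 (goodWord? m n w) * prodFact m n)             ≡⟨ ∑-*ʳ (listsOf N W) (prodFact m n) (λ w → 𝟙 (goodWord? m n w)) ⟩
    ∑[ w ∈ listsOf N W ] 𝟙 (goodWord? m n w) * prodFact m n               ≡⟨ cong (_* prodFact m n) (length-filter≡∑𝟙 (goodWord? m n) (listsOf N W)) ⟨
    S m n * prodFact m n                                                 ∎
    where
    open ≡-Reasoning
    N : ℕ
    N = total m n
    weight : ∀ {w} → length w ≡ N → 𝟙 (properlyColoured? w) * fibreSize w ≡ 𝟙 (goodWord? m n w) * prodFact m n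
    weight {w} |w|≡N = begin
      𝟙 (properlyColoured? w) * fibreSize w                   ≡⟨ cong (𝟙 (properlyColoured? w) *_) (fibreSize-length-N w |w|≡N) ⟩
      𝟙 (properlyColoured? w) * (𝟙 balanced? * prodFact m n) ≡⟨ *-CS.x∙yz≈y∙xz (𝟙 (properlyColoured? w)) (𝟙 balanced?) _ ⟩
      𝟙 balanced? * (𝟙 (properlyColoured? w) * prodFact m n) ≡⟨ *-assoc (𝟙 balanced?) _ _ ⟨
      𝟙 balanced? * 𝟙 (properlyColoured? w) * prodFact m n   ≡⟨ cong (_* prodFact m n) (𝟙-× balanced? (properlyColoured? w)) ⟨
      𝟙 (goodWord? m n w) * prodFact m n                      ∎
      where
      balanced? : Dec (∀ i → occ i w ≡ n i)
      balanced? = allDec (λ i → occ i w ≟ n i)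

mainTheorem8 : (m : ℕ) → 2 ≤ m → (n : Fin m → ℕ) → ((i : Fin m) → 1 ≤ n i) →
    3 ≤ total m n →
    (Hdir m n * total m n ≡ prodFact m n * S m n) × (Hdir m n ≡ 2 * Hund m n)
mainTheorem8 m _ n _ N≥3 = Hdir*N≡∏n!*S , Hdir≡2*Hund N≥3
  where
  open HamiltonianCycles m n
  open ColourWords m n using (length-hamSeqs)
  open ≡-Reasoning
  Hdir*N≡∏n!*S : Hdir m n * N ≡ prodFact m n * S m n
  Hdir*N≡∏n!*S = begin
    Hdir m n * N         ≡⟨ *-comm (Hdir m n) N ⟩
    N * Hdir m n         ≡⟨ length-hamSeqs≡N*Hdir (<-≤-trans (s≤s z≤n) N≥3) ⟨
    length (hamSeqs m n) ≡⟨ length-hamSeqs ⟩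
    S m n * prodFact m n ≡⟨ *-comm (S m n) (prodFact m n) ⟩
    prodFact m n * S m n ∎
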